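{- Let $k_i>0$ for all $i\in\mathbb{Z}/f\mathbb{Z}$ and let $(A^{(i)}),(B^{(i)})\in\mathrm{GL}_2(\mathscr O_F)^f$ with $(A^{(i)})\sim_{\mathbf k}(B^{(i)})$. Write $A^{(i)}=(a^{(i)}_{rs})$ and $B^{(i)}=(b^{(i)}_{rs})$. Then for every $i$ and every $\ell\in\{1,2\}$, $a^{(i)}_{2\ell}\in\mathscr O_F^*$ if and only if $b^{(i)}_{2\ell}\in\mathscr O_F^*$.
   Context: $\mathscr O_F$ is the ring of integers of a finite extension $F/\mathbb{Q}_p$ and $f\ge1$. For $\mathbf k=(k_i)_{i\in\mathbb{Z}/f\mathbb{Z}}$ put $\Delta_{\mathbf k^{(i)}}=\mathrm{Diag}(p^{k_i},1)$, and let $\mathscr P(\mathscr O_F)\subset\mathrm{GL}_2(\mathscr O_F)$ be the group of invertible upper-triangular matrices. $(A^{(i)})\sim_{\mathbf k}(B^{(i)})$ means there exist $C^{(i)}\in\mathscr P(\mathscr O_F)$, $i\in\mathbb{Z}/f\mathbb{Z}$, with $B^{(i)}=C^{(i)}A^{(i)}\Delta_{\mathbf k^{(i-1)}}(C^{(i-1)})^{ -1}\Delta_{\mathbf k^{(i-1)}}^{ -1}$ for all $i$. -}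

module Defs where

open import Level using (Level; _⊔_)
open import Algebra.Bundles using (CommutativeRing)
open import Data.Nat as ℕ using (ℕ; zero; suc)
open import Data.Nat.Primality using (Prime)
open import Data.Fin using (Fin; zero; suc; fromℕ; inject₁)
open import Data.List using (List)
open import Data.List.Relation.Unary.Any using (Any)
open import Data.Product using (Σ; ∃; _×_; _,_)
open import Data.Sum using (_⊎_)
open import Relation.Nullary using (¬_)

-- Cyclic predecessor on ℤ/fℤ, represented as Fin (suc m) with f = suc m.
cpred : ∀ {m} → Fin (suc m) → Fin (suc m)
cpred {m} zero = fromℕ m
cpred (suc i) = inject₁ i

module _ {c ℓ : Level} (R : CommutativeRing c ℓ) where
  open CommutativeRing R hiding (zero)

  IsUnit : Carrier → Set (c ⊔ ℓ)
  IsUnit x = Σ Carrier λ y → x * y ≈ 1#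

  Divides : Carrier → Carrier → Set (c ⊔ ℓ)
  Divides a b = Σ Carrier λ q → b ≈ a * q

  pow : Carrier → ℕ → Carrier
  pow x zero = 1#
  pow x (suc n) = x * pow x n

  natR : ℕ → Carrier
  natR zero = 0#
  natR (suc n) = 1# + natR n

  -- Axiomatic characterisation of "R is (isomorphic to) the ring of
  -- integers O_F of a finite extension F/Q_p": a complete discrete valuation
  -- ring of characteristic 0 whose residue field is finite of characteristic p.
  record IsRingOfIntegersOverQp (p : ℕ) : Set (c ⊔ ℓ) where
    field
      p-prime      : Prime p
      nontrivial   : ¬ (1# ≈ 0#)
      domain       : ∀ x y → x * y ≈ 0# → (x ≈ 0#) ⊎ (y ≈ 0#)
      charZero     : ∀ n → ¬ (natR (suc n) ≈ 0#)
      uniformizer  : Carrier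
      π-nonunit    : ¬ IsUnit uniformizer
      π-nonzero    : ¬ (uniformizer ≈ 0#)
      dvr          : ∀ x → ¬ (x ≈ 0#) →
                     Σ ℕ λ n → Σ Carrier λ u → IsUnit u × (x ≈ u * pow uniformizer n)
      residueChar  : Divides uniformizer (natR p)
      residueFinite : Σ (List Carrier) λ reps →
                     ∀ x → Any (λ r → Divides uniformizer (x - r)) reps
      complete     : ∀ (s : ℕ → Carrier) →
                     (∀ n → Divides (pow uniformizer n) (s (suc n) - s n)) →
                     Σ Carrier λ x → ∀ n → Divides (pow uniformizer n) (x - s n)

  -- 2×2 matrices over R, indexed by row and column in Fin 2
  -- (Fin 2 index zero ↔ paper index 1, suc zero ↔ paper index 2).
  Mat2 : Set c
  Mat2 = Fin 2 → Fin 2 → Carrier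

  mk : Carrier → Carrier → Carrier → Carrier → Mat2
  mk a b c' d zero zero = a
  mk a b c' d zero (suc zero) = b
  mk a b c' d (suc zero) zero = c'
  mk a b c' d (suc zero) (suc zero) = d

  _⊗_ : Mat2 → Mat2 → Mat2
  (M ⊗ N) r s = M r zero * N zero s + M r (suc zero) * N (suc zero) s

  _≈M_ : Mat2 → Mat2 → Set ℓ
  M ≈M N = ∀ r s → M r s ≈ N r s

  I2 : Mat2
  I2 = mk 1# 0# 0# 1#

  det : Mat2 → Carrier
  det M = M zero zero * M (suc zero) (suc zero) - M zero (suc zero) * M (suc zero) zero

  IsGL2 : Mat2 → Set (c ⊔ ℓ)
  IsGL2 M = IsUnit (det M)

  IsP : Mat2 → Set (c ⊔ ℓ)
  IsP M = (M (suc zero) zero ≈ 0#) × IsGL2 M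

  Δ : ℕ → ℕ → Mat2
  Δ p k = mk (pow (natR p) k) 0# 0# 1#

  -- (A⁽ⁱ⁾) ∼_k (B⁽ⁱ⁾): there are C⁽ⁱ⁾ ∈ 𝒫(R) with
  --   B⁽ⁱ⁾ = C⁽ⁱ⁾ A⁽ⁱ⁾ Δ_{k_{i-1}} (C⁽ⁱ⁻¹⁾)⁻¹ Δ_{k_{i-1}}⁻¹,
  -- written equivalently (Δ is invertible over F, and F is not available) as
  --   B⁽ⁱ⁾ Δ_{k_{i-1}} C⁽ⁱ⁻¹⁾ = C⁽ⁱ⁾ A⁽ⁱ⁾ Δ_{k_{i-1}}.
  Equiv : (p : ℕ) {m : ℕ} → (Fin (suc m) → ℕ) →
          (Fin (suc m) → Mat2) → (Fin (suc m) → Mat2) → Set (c ⊔ ℓ)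
  Equiv p k A B = Σ (Fin _ → Mat2) λ C →
    (∀ i → IsP (C i)) ×
    (∀ i → ((B i ⊗ Δ p (k (cpred i))) ⊗ C (cpred i))
             ≈M ((C i ⊗ A i) ⊗ Δ p (k (cpred i))))

{-# OPTIONS --safe #-}
-- Compare the bottom rows of B⁽ⁱ⁾ Δ C⁽ⁱ⁻¹⁾ = C⁽ⁱ⁾ A⁽ⁱ⁾ Δ, where Δ = Diag(pᵏ, 1) and
-- the C's are upper triangular with unit diagonal entries.  The (2,1) entries give
-- b₂₁ c′₁₁ pᵏ = c₂₂ a₂₁ pᵏ; cancelling pᵏ ≠ 0 shows that a₂₁ and b₂₁ are associates.
-- The (2,2) entries give c₂₂ a₂₂ = pᵏ b₂₁ c′₁₂ + b₂₂ c′₂₂, and as k > 0 the first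
-- summand lies in π O_F, so a₂₂ and b₂₂ are associates modulo π.  In the local ring
-- O_F the units are exactly the elements prime to π, which settles both cases.
module Submission where

open import Defs
open import Level using (Level; _⊔_)
open import Algebra.Bundles using (CommutativeRing)
open import Data.Nat as ℕ using (ℕ; suc; _>_; NonZero)
open import Data.Nat.Primality using (prime⇒nonZero)
open import Data.Fin using (Fin; zero; suc)
open import Data.Fin.Patterns using (0F; 1F)
open import Data.Product using (_,_; proj₁)
open import Data.Sum using (_⊎_; inj₁; inj₂)
open import Data.Empty using (⊥-elim)
open import Relation.Nullary using (¬_)
open import Function.Bundles using (_⇔_; mk⇔)
open import Function.Related.Propositional using (module EquationalReasoning; equivalence)
import Function.Properties.Equivalence as ⇔
import Algebra.Properties.AbelianGroup as AbelianGroupProperties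
import Algebra.Properties.CommutativeSemigroup as CommutativeSemigroupProperties
import Algebra.Properties.Group as GroupProperties
import Algebra.Properties.Ring as RingProperties
import Relation.Binary.Reasoning.Setoid as SetoidReasoning

module UnitsAndDivisors {c ℓ : Level} (R : CommutativeRing c ℓ) where
  open CommutativeRing R
  open CommutativeSemigroupProperties *-commutativeSemigroup using (interchange; x∙yz≈y∙xz)
  open RingProperties ring using (-‿distribʳ-*)

  IsUnit-resp-≈ : ∀ {x y} → x ≈ y → IsUnit R x → IsUnit R y
  IsUnit-resp-≈ x≈y (w , xw≈1) = w , trans (*-congʳ (sym x≈y)) xw≈1

  IsUnit-cong : ∀ {x y} → x ≈ y → IsUnit R x ⇔ IsUnit R y
  IsUnit-cong x≈y = mk⇔ (IsUnit-resp-≈ x≈y) (IsUnit-resp-≈ (sym x≈y))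

  IsUnit-* : ∀ {x y} → IsUnit R x → IsUnit R y → IsUnit R (x * y)
  IsUnit-* {x} {y} (v , xv≈1) (w , yw≈1) = v * w , (begin
    (x * y) * (v * w) ≈⟨ interchange x y v w ⟩
    (x * v) * (y * w) ≈⟨ *-cong xv≈1 yw≈1 ⟩
    1# * 1#           ≈⟨ *-identityˡ 1# ⟩
    1#                ∎)
    where open SetoidReasoning setoid

  IsUnit-*⇒IsUnitˡ : ∀ {x y} → IsUnit R (x * y) → IsUnit R x
  IsUnit-*⇒IsUnitˡ {x} {y} (w , xyw≈1) = y * w , trans (sym (*-assoc x y w)) xyw≈1

  IsUnit-*⇒IsUnitʳ : ∀ {x y} → IsUnit R (x * y) → IsUnit R y
  IsUnit-*⇒IsUnitʳ {x} {y} xy-unit = IsUnit-*⇒IsUnitˡ (IsUnit-resp-≈ (*-comm x y) xy-unit)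

  IsUnit-*ˡ⇔ : ∀ {u x} → IsUnit R u → IsUnit R (u * x) ⇔ IsUnit R x
  IsUnit-*ˡ⇔ u-unit = mk⇔ IsUnit-*⇒IsUnitʳ (IsUnit-* u-unit)

  IsUnit-*ʳ⇔ : ∀ {u x} → IsUnit R u → IsUnit R (x * u) ⇔ IsUnit R x
  IsUnit-*ʳ⇔ u-unit = mk⇔ IsUnit-*⇒IsUnitˡ (λ x-unit → IsUnit-* x-unit u-unit)

  associates⇒IsUnit⇔ : ∀ {u v x y} → IsUnit R u → IsUnit R v →
                       u * x ≈ y * v → IsUnit R x ⇔ IsUnit R y
  associates⇒IsUnit⇔ {u} {v} {x} {y} u-unit v-unit ux≈yv = begin
    IsUnit R x       ∼⟨ ⇔.sym (IsUnit-*ˡ⇔ u-unit) ⟩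
    IsUnit R (u * x) ∼⟨ IsUnit-cong ux≈yv ⟩
    IsUnit R (y * v) ∼⟨ IsUnit-*ʳ⇔ v-unit ⟩
    IsUnit R y       ∎
    where open EquationalReasoning {k = equivalence}

  Divides-resp-≈ : ∀ {a x y} → x ≈ y → Divides R a x → Divides R a y
  Divides-resp-≈ x≈y (q , x≈aq) = q , trans (sym x≈y) x≈aq

  Divides-*ʳ : ∀ {a x} y → Divides R a x → Divides R a (x * y)
  Divides-*ʳ {a} y (q , x≈aq) = q * y , trans (*-congʳ x≈aq) (*-assoc a q y)

  Divides-*ˡ : ∀ {a x} y → Divides R a x → Divides R a (y * x)
  Divides-*ˡ {a} y (q , x≈aq) = y * q , trans (*-congˡ x≈aq) (x∙yz≈y∙xz y a q)

  Divides-+ : ∀ {a x y} → Divides R a x → Divides R a y → Divides R a (x + y)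
  Divides-+ {a} (q , x≈aq) (r , y≈ar) = q + r , trans (+-cong x≈aq y≈ar) (sym (distribˡ a q r))

  Divides-‿ : ∀ {a x} → Divides R a x → Divides R a (- x)
  Divides-‿ {a} (q , x≈aq) = - q , trans (-‿cong x≈aq) (-‿distribʳ-* a q)

  nonunit∤unit : ∀ {a x} → ¬ IsUnit R a → IsUnit R x → ¬ Divides R a x
  nonunit∤unit {a} {x} a-nonunit (w , xw≈1) (q , x≈aq) = a-nonunit (q * w , (begin
    a * (q * w) ≈⟨ *-assoc a q w ⟨
    (a * q) * w ≈⟨ *-congʳ x≈aq ⟨
    x * w       ≈⟨ xw≈1 ⟩
    1#          ∎))
    where open SetoidReasoning setoid

module IntegralDomain {c ℓ : Level} (R : CommutativeRing c ℓ) where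
  open CommutativeRing R
  open RingProperties ring using ([y-z]x≈yx-zx)
  open GroupProperties +-group using (x∙y⁻¹≈ε⇒x≈y)
  open SetoidReasoning setoid

  NoZeroDivisors : Set (c ⊔ ℓ)
  NoZeroDivisors = ∀ x y → x * y ≈ 0# → (x ≈ 0#) ⊎ (y ≈ 0#)

  *-cancelʳ-≉0 : NoZeroDivisors → ∀ {q x y} → ¬ q ≈ 0# → x * q ≈ y * q → x ≈ y
  *-cancelʳ-≉0 domain {q} {x} {y} q≉0 xq≈yq with domain (x - y) q (begin
    (x - y) * q   ≈⟨ [y-z]x≈yx-zx q x y ⟩
    x * q - y * q ≈⟨ +-congʳ xq≈yq ⟩
    y * q - y * q ≈⟨ -‿inverseʳ (y * q) ⟩
    0#            ∎)
  ... | inj₁ x-y≈0 = x∙y⁻¹≈ε⇒x≈y x y x-y≈0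
  ... | inj₂ q≈0   = ⊥-elim (q≉0 q≈0)

  pow-≉0 : ¬ 1# ≈ 0# → NoZeroDivisors → ∀ {x} → ¬ x ≈ 0# → ∀ n → ¬ pow R x n ≈ 0#
  pow-≉0 1≉0 domain x≉0 ℕ.zero = 1≉0
  pow-≉0 1≉0 domain {x} x≉0 (suc n) xxⁿ≈0 with domain x (pow R x n) xxⁿ≈0
  ... | inj₁ x≈0  = x≉0 x≈0
  ... | inj₂ xⁿ≈0 = pow-≉0 1≉0 domain x≉0 n xⁿ≈0

module UpperTriangular {c ℓ : Level} (R : CommutativeRing c ℓ) where
  open CommutativeRing R
  open UnitsAndDivisors R using (IsUnit-resp-≈; IsUnit-*⇒IsUnitˡ; IsUnit-*⇒IsUnitʳ)
  open RingProperties ring using (-0#≈0#)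
  open CommutativeSemigroupProperties *-commutativeSemigroup using (xy∙z≈xz∙y)
  open SetoidReasoning setoid

  infixl 7 _⊗ᴿ_
  _⊗ᴿ_ : Mat2 R → Mat2 R → Mat2 R
  M ⊗ᴿ N = _⊗_ R M N

  module _ (N : Mat2 R) (N₁₀≈0 : N 1F 0F ≈ 0#) where

    det-upper : det R N ≈ N 0F 0F * N 1F 1F
    det-upper = begin
      N 0F 0F * N 1F 1F - N 0F 1F * N 1F 0F ≈⟨ +-congˡ (-‿cong (*-congˡ N₁₀≈0)) ⟩
      N 0F 0F * N 1F 1F - N 0F 1F * 0#      ≈⟨ +-congˡ (trans (-‿cong (zeroʳ _)) -0#≈0#) ⟩
      N 0F 0F * N 1F 1F + 0#                ≈⟨ +-identityʳ _ ⟩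
      N 0F 0F * N 1F 1F                     ∎

    ⊗-upper-col₀ : ∀ M r → (M ⊗ᴿ N) r 0F ≈ M r 0F * N 0F 0F
    ⊗-upper-col₀ M r = trans (+-congˡ (trans (*-congˡ N₁₀≈0) (zeroʳ _))) (+-identityʳ _)

    upper-⊗-row₁ : ∀ M s → (N ⊗ᴿ M) 1F s ≈ N 1F 1F * M 1F s
    upper-⊗-row₁ M s = trans (+-congʳ (trans (*-congʳ N₁₀≈0) (zeroˡ _))) (+-identityˡ _)

  IsP⇒IsUnit₀₀ : ∀ N → IsP R N → IsUnit R (N 0F 0F)
  IsP⇒IsUnit₀₀ N (N₁₀≈0 , det-unit) = IsUnit-*⇒IsUnitˡ (IsUnit-resp-≈ (det-upper N N₁₀≈0) det-unit)

  IsP⇒IsUnit₁₁ : ∀ N → IsP R N → IsUnit R (N 1F 1F)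
  IsP⇒IsUnit₁₁ N (N₁₀≈0 , det-unit) = IsUnit-*⇒IsUnitʳ (IsUnit-resp-≈ (det-upper N N₁₀≈0) det-unit)

  module _ (p k : ℕ) where

    ⊗-Δ-col₀ : ∀ M r → (M ⊗ᴿ Δ R p k) r 0F ≈ M r 0F * pow R (natR R p) k
    ⊗-Δ-col₀ M r = trans (+-congˡ (zeroʳ _)) (+-identityʳ _)

    ⊗-Δ-col₁ : ∀ M r → (M ⊗ᴿ Δ R p k) r 1F ≈ M r 1F
    ⊗-Δ-col₁ M r = trans (+-cong (zeroʳ _) (*-identityʳ _)) (+-identityˡ _)

    module _ (A B C C′ : Mat2 R)
      (BΔC′≈CAΔ : _≈M_ R ((B ⊗ᴿ Δ R p k) ⊗ᴿ C′) ((C ⊗ᴿ A) ⊗ᴿ Δ R p k))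
      (C₁₀≈0 : C 1F 0F ≈ 0#)
      where

      twisted-entry₁₀ : C′ 1F 0F ≈ 0# →
        (B 1F 0F * C′ 0F 0F) * pow R (natR R p) k ≈ (C 1F 1F * A 1F 0F) * pow R (natR R p) k
      twisted-entry₁₀ C′₁₀≈0 = begin
        (B 1F 0F * C′ 0F 0F) * pow R (natR R p) k  ≈⟨ xy∙z≈xz∙y _ _ _ ⟩
        (B 1F 0F * pow R (natR R p) k) * C′ 0F 0F  ≈⟨ *-congʳ (⊗-Δ-col₀ B 1F) ⟨
        (B ⊗ᴿ Δ R p k) 1F 0F * C′ 0F 0F            ≈⟨ ⊗-upper-col₀ C′ C′₁₀≈0 (B ⊗ᴿ Δ R p k) 1F ⟨
        ((B ⊗ᴿ Δ R p k) ⊗ᴿ C′) 1F 0F               ≈⟨ BΔC′≈CAΔ 1F 0F ⟩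
        ((C ⊗ᴿ A) ⊗ᴿ Δ R p k) 1F 0F                ≈⟨ ⊗-Δ-col₀ (C ⊗ᴿ A) 1F ⟩
        (C ⊗ᴿ A) 1F 0F * pow R (natR R p) k        ≈⟨ *-congʳ (upper-⊗-row₁ C C₁₀≈0 A 0F) ⟩
        (C 1F 1F * A 1F 0F) * pow R (natR R p) k   ∎

      twisted-entry₁₁ :
        (B 1F 0F * pow R (natR R p) k) * C′ 0F 1F + B 1F 1F * C′ 1F 1F ≈ C 1F 1F * A 1F 1F
      twisted-entry₁₁ = begin
        (B 1F 0F * pow R (natR R p) k) * C′ 0F 1F + B 1F 1F * C′ 1F 1F
          ≈⟨ +-cong (*-congʳ (⊗-Δ-col₀ B 1F)) (*-congʳ (⊗-Δ-col₁ B 1F)) ⟨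
        ((B ⊗ᴿ Δ R p k) ⊗ᴿ C′) 1F 1F  ≈⟨ BΔC′≈CAΔ 1F 1F ⟩
        ((C ⊗ᴿ A) ⊗ᴿ Δ R p k) 1F 1F   ≈⟨ ⊗-Δ-col₁ (C ⊗ᴿ A) 1F ⟩
        (C ⊗ᴿ A) 1F 1F                ≈⟨ upper-⊗-row₁ C C₁₀≈0 A 1F ⟩
        C 1F 1F * A 1F 1F             ∎

module RingOfIntegers {c ℓ : Level} (R : CommutativeRing c ℓ) (p : ℕ) (O : IsRingOfIntegersOverQp R p) where
  open CommutativeRing R
  open IsRingOfIntegersOverQp O
  open UnitsAndDivisors R
  open IntegralDomain R using (pow-≉0)
  open AbelianGroupProperties +-abelianGroup using (xyx⁻¹≈y)

  π : Carrier
  π = uniformizer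

  π∤⇒IsUnit : ∀ {x} → ¬ Divides R π x → IsUnit R x
  π∤⇒IsUnit {x} π∤x with dvr x (λ x≈0 → π∤x (0# , trans x≈0 (sym (zeroʳ π))))
  ... | ℕ.zero , u , u-unit , x≈u·1  = IsUnit-resp-≈ (sym (trans x≈u·1 (*-identityʳ u))) u-unit
  ... | suc n  , u , _      , x≈uππⁿ =
    ⊥-elim (π∤x (Divides-resp-≈ (sym x≈uππⁿ) (Divides-*ˡ u (pow R π n , refl))))

  IsUnit⇒π∤ : ∀ {x} → IsUnit R x → ¬ Divides R π x
  IsUnit⇒π∤ = nonunit∤unit π-nonunit

  IsUnit-+-π∣ : ∀ {δ y} → Divides R π δ → IsUnit R (δ + y) ⇔ IsUnit R y
  IsUnit-+-π∣ {δ} {y} π∣δ = mk⇔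
    (λ δ+y-unit → π∤⇒IsUnit (λ π∣y → IsUnit⇒π∤ δ+y-unit (Divides-+ π∣δ π∣y)))
    (λ y-unit → π∤⇒IsUnit (λ π∣δ+y →
      IsUnit⇒π∤ y-unit (Divides-resp-≈ (xyx⁻¹≈y δ y) (Divides-+ π∣δ+y (Divides-‿ π∣δ)))))

  associates-mod-π⇒IsUnit⇔ : ∀ {u v δ x y} → IsUnit R u → IsUnit R v → Divides R π δ →
                             u * x ≈ δ + y * v → IsUnit R x ⇔ IsUnit R y
  associates-mod-π⇒IsUnit⇔ {u} {v} {δ} {x} {y} u-unit v-unit π∣δ ux≈δ+yv = begin
    IsUnit R x           ∼⟨ ⇔.sym (IsUnit-*ˡ⇔ u-unit) ⟩
    IsUnit R (u * x)     ∼⟨ IsUnit-cong ux≈δ+yv ⟩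
    IsUnit R (δ + y * v) ∼⟨ IsUnit-+-π∣ π∣δ ⟩
    IsUnit R (y * v)     ∼⟨ IsUnit-*ʳ⇔ v-unit ⟩
    IsUnit R y           ∎
    where open EquationalReasoning {k = equivalence}

  π∣pᵏ : ∀ k → k > 0 → Divides R π (pow R (natR R p) k)
  π∣pᵏ (suc k) _ = Divides-*ʳ (pow R (natR R p) k) residueChar

  pᵏ≉0 : ∀ k → ¬ pow R (natR R p) k ≈ 0#
  pᵏ≉0 = pow-≉0 nontrivial domain (natR-≉0 p (prime⇒nonZero p-prime))
    where
    natR-≉0 : ∀ n → NonZero n → ¬ natR R n ≈ 0#
    natR-≉0 (suc n) _ = charZero n

lemma4p1 : ∀ {c ℓ : Level} (R : CommutativeRing c ℓ) (p : ℕ) →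
    IsRingOfIntegersOverQp R p →
    ∀ (m : ℕ) (k : Fin (suc m) → ℕ) → (∀ i → k i > 0) →
    (A B : Fin (suc m) → Mat2 R) →
    (∀ i → IsGL2 R (A i)) → (∀ i → IsGL2 R (B i)) →
    Equiv R p k A B →
    ∀ (i : Fin (suc m)) (l : Fin 2) →
      IsUnit R (A i (suc zero) l) ⇔ IsUnit R (B i (suc zero) l)
lemma4p1 R p O m k k>0 A B _ _ (C , C∈𝒫 , BΔC≈CAΔ) i = bottom-row
  where
  open CommutativeRing R using (sym)
  open IsRingOfIntegersOverQp O using (domain)
  open UnitsAndDivisors R using (associates⇒IsUnit⇔; Divides-*ˡ; Divides-*ʳ)
  open IntegralDomain R using (*-cancelʳ-≉0)
  open UpperTriangular R using (IsP⇒IsUnit₀₀; IsP⇒IsUnit₁₁; twisted-entry₁₀; twisted-entry₁₁)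
  open RingOfIntegers R p O using (associates-mod-π⇒IsUnit⇔; π∣pᵏ; pᵏ≉0)

  j : Fin (suc m)
  j = cpred i

  bottom-row : ∀ l → IsUnit R (A i 1F l) ⇔ IsUnit R (B i 1F l)
  bottom-row 0F = associates⇒IsUnit⇔ (IsP⇒IsUnit₁₁ (C i) (C∈𝒫 i)) (IsP⇒IsUnit₀₀ (C j) (C∈𝒫 j))
    (sym (*-cancelʳ-≉0 domain (pᵏ≉0 (k j))
      (twisted-entry₁₀ p (k j) (A i) (B i) (C i) (C j) (BΔC≈CAΔ i) (proj₁ (C∈𝒫 i)) (proj₁ (C∈𝒫 j)))))
  bottom-row 1F = associates-mod-π⇒IsUnit⇔ (IsP⇒IsUnit₁₁ (C i) (C∈𝒫 i)) (IsP⇒IsUnit₁₁ (C j) (C∈𝒫 j))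
    (Divides-*ʳ _ (Divides-*ˡ _ (π∣pᵏ (k j) (k>0 j))))
    (sym (twisted-entry₁₁ p (k j) (A i) (B i) (C i) (C j) (BΔC≈CAΔ i) (proj₁ (C∈𝒫 i))))
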